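{- Let $R$ be a countable ring with unit, $I\subseteq R$ a maximal left ideal, and let $(V,X,V_n)_{n\in\omega}$ consist of a left $R$-module $V$, left submodules $V_n$ ($n\in\omega$), and an $I$-basis $X$ of $V$. Then the statement "for all $a\in\Delta(V)$, $a\in R*X$ if and only if $a\notin\bigcup_{n\in\omega}V_n$" holds if and only if $R*X=R*\bigl(\Delta(V)\setminus\bigcup_{n\in\omega}V_n\bigr)$. In particular, if these hold then $R*X$ is invariant in $(V,V_n)_{n\in\omega}$, i.e. preserved setwise by every automorphism of the structure $(V,V_n)_{n\in\omega}$.
   Context: $X\subseteq V$ is $I$-independent if for all distinct $x_0,\dots,x_{n-1}\in X$ and all $r_i\in R$: $\sum_{i<n}r_ix_i=0$ iff every $r_i\in I$; $X$ is an $I$-basis if it is $I$-independent and generates $V$. $\Delta(V)$ is the set of $a\in V$ with $\mathrm{Ann}(a)=\{s\in R: sa=0\}$ equal to $I$. For $Y\subseteq V$, $R*Y=\{ry: r\in R, y\in Y, ry\neq0\}$. -}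

module Defs where

open import Level using (Level; _⊔_) renaming (suc to lsuc)
open import Data.Nat using (ℕ; zero)
open import Data.Nat as ℕ using ()
open import Data.Fin using (Fin; zero; suc)
open import Data.Product using (Σ; ∃; _×_; _,_)
open import Data.Sum using (_⊎_)
open import Relation.Nullary using (¬_)
open import Relation.Binary.PropositionalEquality using (_≡_)
open import Relation.Unary using (Pred; _∈_; _⊆_)
open import Function.Definitions using (Surjective)
open import Algebra.Bundles using (Ring)
open import Algebra.Module.Bundles using (LeftModule)
open import Algebra.Module.Morphism.Structures using (module LeftModuleMorphisms)

private variable
  c ℓ m ℓm p q : Level

infix 2 _⇔′_ _≐′_

_⇔′_ : ∀ {a b} → Set a → Set b → Set (a ⊔ b)
A ⇔′ B = (A → B) × (B → A)

_≐′_ : ∀ {a} {A : Set a} → Pred A p → Pred A q → Set (a ⊔ p ⊔ q)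
P ≐′ Q = ∀ x → (P x ⇔′ Q x)

module _ (R : Ring c ℓ) where
  open Ring R

  -- R is countable: there is a surjection ℕ → R (R is nonempty, having 1)
  Countable : Set (c ⊔ ℓ)
  Countable = Σ (ℕ → Carrier) λ e → ∀ r → ∃ λ n → e n ≈ r

  IsLeftIdeal : Pred Carrier p → Set (c ⊔ ℓ ⊔ p)
  IsLeftIdeal J =
    (∀ {x y} → x ≈ y → J x → J y) ×
    (0# ∈ J) ×
    (∀ {x y} → J x → J y → J (x + y)) ×
    (∀ r {x} → J x → J (r * x))

  IsMaximalLeftIdeal : Pred Carrier p → Set (c ⊔ ℓ ⊔ lsuc p)
  IsMaximalLeftIdeal {p} I =
    IsLeftIdeal I ×
    ¬ (1# ∈ I) ×
    (∀ (J : Pred Carrier p) → IsLeftIdeal J → I ⊆ J →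
       (J ⊆ I) ⊎ (∀ r → r ∈ J))

module _ {R : Ring c ℓ} (M : LeftModule R m ℓm) where
  open Ring R using () renaming (Carrier to R₀; _≈_ to _≈ᴿ_)
  open LeftModule M

  lincomb : ∀ n → (Fin n → R₀) → (Fin n → Carrierᴹ) → Carrierᴹ
  lincomb zero    r x = 0ᴹ
  lincomb (ℕ.suc n) r x = (r zero *ₗ x zero) +ᴹ lincomb n (λ i → r (suc i)) (λ i → x (suc i))

  IsSubmodule : Pred Carrierᴹ p → Set (c ⊔ m ⊔ ℓm ⊔ p)
  IsSubmodule W =
    (∀ {x y} → x ≈ᴹ y → W x → W y) ×
    (0ᴹ ∈ W) ×
    (∀ {x y} → W x → W y → W (x +ᴹ y)) ×
    (∀ r {x} → W x → W (r *ₗ x))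

  IsIndependent : Pred R₀ q → Pred Carrierᴹ p → Set (c ⊔ m ⊔ ℓm ⊔ p ⊔ q)
  IsIndependent I X =
    ∀ n (x : Fin n → Carrierᴹ) → (∀ i → x i ∈ X) →
    (∀ i j → x i ≈ᴹ x j → i ≡ j) →
    ∀ (r : Fin n → R₀) → ((lincomb n r x ≈ᴹ 0ᴹ) ⇔′ (∀ i → r i ∈ I))

  Generates : Pred Carrierᴹ p → Set (c ⊔ m ⊔ ℓm ⊔ p)
  Generates X =
    ∀ v → ∃ λ n → Σ (Fin n → Carrierᴹ) λ x → (∀ i → x i ∈ X) ×
      Σ (Fin n → R₀) λ r → v ≈ᴹ lincomb n r x

  IsBasis : Pred R₀ q → Pred Carrierᴹ p → Set (c ⊔ m ⊔ ℓm ⊔ p ⊔ q)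
  IsBasis I X = IsIndependent I X × Generates X

  Δ : Pred R₀ q → Pred Carrierᴹ (c ⊔ ℓm ⊔ q)
  Δ I a = ∀ s → ((s *ₗ a ≈ᴹ 0ᴹ) ⇔′ (s ∈ I))

  Rstar : Pred Carrierᴹ p → Pred Carrierᴹ (c ⊔ m ⊔ ℓm ⊔ p)
  Rstar Y a = Σ R₀ λ r → Σ Carrierᴹ λ y → (y ∈ Y) × ¬ (r *ₗ y ≈ᴹ 0ᴹ) × (a ≈ᴹ r *ₗ y)

  ⋃ω : (ℕ → Pred Carrierᴹ p) → Pred Carrierᴹ p
  ⋃ω W a = ∃ λ n → a ∈ W n

  IsAutomorphism : (ℕ → Pred Carrierᴹ p) → (Carrierᴹ → Carrierᴹ) → Set (c ⊔ m ⊔ ℓm ⊔ p)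
  IsAutomorphism W f =
    LeftModuleMorphisms.IsLeftModuleIsomorphism rawLeftModule rawLeftModule f ×
    (∀ n a → (a ∈ W n) ⇔′ (f a ∈ W n))

  -- S is invariant under f (f a bijection): f[S] = S
  InvariantUnder : Pred Carrierᴹ p → (Carrierᴹ → Carrierᴹ) → Set (m ⊔ p)
  InvariantUnder S f = ∀ a → (a ∈ S) ⇔′ (f a ∈ S)

{-# OPTIONS --safe #-}

-- If Ann(y) = I is maximal and r y ≠ 0, then r ∉ I, so I + R r = R: 1 = u + t r with u ∈ I,
-- whence y = −t (r y). So an element of Δ(V) is recovered from any nonzero multiple of it;
-- hence r y ∈ Vₙ forces y ∈ Vₙ, and R * (R * Y) ⊆ R * Y. These two facts give both directions
-- of the equivalence, and invariance follows because Δ(V) ∖ ⋃ Vₙ is preserved by every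
-- automorphism of (V, Vₙ).

module Submission where

open import Defs
open import Level using (Level; _⊔_)
open import Data.Nat using (ℕ)
open import Data.Product using (_×_; ∃; _,_; proj₁; proj₂)
open import Data.Sum using ([_,_])
open import Function using (_∘_)
open import Relation.Nullary using (¬_; contradiction)
open import Relation.Unary using (Pred; _∈_; _∩_; ∁; _⊆_)
open import Algebra.Bundles using (Ring)
open import Algebra.Module.Bundles using (LeftModule)
open import Algebra.Module.Morphism.Structures using (module LeftModuleMorphisms)
import Data.Fin as Fin
import Relation.Binary.PropositionalEquality as ≡
import Algebra.Properties.CommutativeSemigroup as CommutativeSemigroupProperties
import Relation.Binary.Reasoning.Setoid as SetoidReasoning

private variable
  a c ℓ m ℓm p q : Level
  A : Set a

≐′-intro : {P : Pred A p} {Q : Pred A q} → P ⊆ Q → Q ⊆ P → P ≐′ Q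
≐′-intro P⊆Q Q⊆P x = P⊆Q , Q⊆P

module _ (R : Ring c ℓ) where
  open Ring R
  open CommutativeSemigroupProperties +-commutativeSemigroup using (interchange)
  open SetoidReasoning setoid

  +-*-cancelʳ : ∀ u t r → (u + t * r) + - t * r ≈ u
  +-*-cancelʳ u t r = begin
    (u + t * r) + - t * r  ≈⟨ +-assoc u (t * r) (- t * r) ⟩
    u + (t * r + - t * r)  ≈⟨ +-congˡ (distribʳ r t (- t)) ⟨
    u + (t + - t) * r      ≈⟨ +-congˡ (trans (*-congʳ (-‿inverseʳ t)) (zeroˡ r)) ⟩
    u + 0#                 ≈⟨ +-identityʳ u ⟩
    u                      ∎

  x∉maximal⇒1∈I+Rx : Countable R → {I : Pred Carrier q} → IsMaximalLeftIdeal R I →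
                      ∀ {x} → ¬ I x → ∃ λ t → I (1# + t * x)
  x∉maximal⇒1∈I+Rx {q} (e , e-onto) {I} ((I-resp , 0∈I , I-+ , I-*) , _ , maximal) {x} x∉I =
    [ (λ I+Rx⊆I → contradiction (I+Rx⊆I x∈I+Rx) x∉I) , 1∈I+Rx ]
      (maximal I+Rx I+Rx-isLeftIdeal I⊆I+Rx)
    where
      -- The coefficient ranges over the enumeration of R, not over R itself, so that
      -- this predicate lives in the universe of I, as maximality requires.
      I+Rx : Pred Carrier q
      I+Rx u = ∃ λ k → I (u + e k * x)

      I+Rx-intro : ∀ {u} s → I (u + s * x) → I+Rx u
      I+Rx-intro s u+sx∈I =
        let (k , ek≈s) = e-onto s in k , I-resp (+-congˡ (*-congʳ (sym ek≈s))) u+sx∈I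

      I+Rx-isLeftIdeal : IsLeftIdeal R I+Rx
      I+Rx-isLeftIdeal =
          (λ u≈v (k , h) → k , I-resp (+-congʳ u≈v) h)
        , I+Rx-intro 0# (I-resp (sym (trans (+-identityˡ _) (zeroˡ x))) 0∈I)
        , (λ {u} {v} (k , h) (k′ , h′) → I+Rx-intro (e k + e k′) (I-resp
            (trans (interchange u (e k * x) v (e k′ * x))
                   (+-congˡ (sym (distribʳ x (e k) (e k′)))))
            (I-+ h h′)))
        , (λ t {u} (k , h) → I+Rx-intro (t * e k) (I-resp
            (trans (distribˡ t u (e k * x)) (+-congˡ (sym (*-assoc t (e k) x))))
            (I-* t h)))

      I⊆I+Rx : I ⊆ I+Rx
      I⊆I+Rx {u} u∈I = I+Rx-intro 0# (I-resp (sym (trans (+-congˡ (zeroˡ x)) (+-identityʳ u))) u∈I)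

      x∈I+Rx : I+Rx x
      x∈I+Rx = I+Rx-intro (- 1#) (I-resp (sym x-x≈0) 0∈I)
        where
          x-x≈0 : x + - 1# * x ≈ 0#
          x-x≈0 = begin
            x + - 1# * x       ≈⟨ +-congʳ (sym (*-identityˡ x)) ⟩
            1# * x + - 1# * x  ≈⟨ distribʳ x 1# (- 1#) ⟨
            (1# + - 1#) * x    ≈⟨ *-congʳ (-‿inverseʳ 1#) ⟩
            0# * x             ≈⟨ zeroˡ x ⟩
            0#                 ∎

      1∈I+Rx : (∀ u → I+Rx u) → ∃ λ t → I (1# + t * x)
      1∈I+Rx everything = let (k , h) = everything 1# in e k , h

module LeftModuleProperties {R : Ring c ℓ} (V : LeftModule R m ℓm) where
  open Ring R
  open LeftModule V
  open SetoidReasoning ≈ᴹ-setoid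
  open LeftModuleMorphisms rawLeftModule rawLeftModule using (IsLeftModuleIsomorphism)

  Δ-resp-≈ : {I : Pred Carrier q} → ∀ {y z} → y ≈ᴹ z → y ∈ Δ V I → z ∈ Δ V I
  Δ-resp-≈ y≈z y∈Δ s =
      (λ sz≈0 → proj₁ (y∈Δ s) (≈ᴹ-trans (*ₗ-congˡ y≈z) sz≈0))
    , (λ s∈I → ≈ᴹ-trans (*ₗ-congˡ (≈ᴹ-sym y≈z)) (proj₂ (y∈Δ s) s∈I))

  ⋃ω-resp-≈ : {W : ℕ → Pred Carrierᴹ p} → (∀ n → IsSubmodule V (W n)) →
              ∀ {y z} → y ≈ᴹ z → y ∈ ⋃ω V W → z ∈ ⋃ω V W
  ⋃ω-resp-≈ W-sub y≈z (n , y∈Wn) = n , proj₁ (W-sub n) y≈z y∈Wn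

  independent⇒⊆Δ : {I : Pred Carrier q} {X : Pred Carrierᴹ p} →
                   IsIndependent V I X → X ⊆ Δ V I
  independent⇒⊆Δ {I = I} independent {x} x∈X s =
      (λ sx≈0 → proj₁ singleton (≈ᴹ-trans (+ᴹ-identityʳ _) sx≈0) Fin.zero)
    , (λ s∈I → ≈ᴹ-trans (≈ᴹ-sym (+ᴹ-identityʳ _)) (proj₂ singleton (λ _ → s∈I)))
    where
      singleton : (lincomb V 1 (λ _ → s) (λ _ → x) ≈ᴹ 0ᴹ) ⇔′ (Fin.Fin 1 → s ∈ I)
      singleton = independent 1 (λ _ → x) (λ _ → x∈X) (λ { Fin.zero Fin.zero _ → ≡.refl }) (λ _ → s)

  Rstar-mono : {Y : Pred Carrierᴹ p} {Z : Pred Carrierᴹ q} → Y ⊆ Z → Rstar V Y ⊆ Rstar V Z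
  Rstar-mono Y⊆Z (r , y , y∈Y , ry≉0 , a≈ry) = r , y , Y⊆Z y∈Y , ry≉0 , a≈ry

  Rstar-Rstar⊆Rstar : {Y : Pred Carrierᴹ p} → Rstar V (Rstar V Y) ⊆ Rstar V Y
  Rstar-Rstar⊆Rstar (r , y , (s , x , x∈Y , _ , y≈sx) , ry≉0 , a≈ry) =
    r * s , x , x∈Y , ry≉0 ∘ ≈ᴹ-trans r[sx]≈[rs]x , ≈ᴹ-trans a≈ry r[sx]≈[rs]x
    where
      r[sx]≈[rs]x : r *ₗ y ≈ᴹ (r * s) *ₗ x
      r[sx]≈[rs]x = ≈ᴹ-trans (*ₗ-congˡ y≈sx) (≈ᴹ-sym (*ₗ-assoc r s x))

  ⊆Δ⇒⊆Rstar : {I : Pred Carrier q} {Y : Pred Carrierᴹ p} →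
              ¬ (1# ∈ I) → Y ⊆ Δ V I → Y ⊆ Rstar V Y
  ⊆Δ⇒⊆Rstar 1∉I Y⊆Δ {y} y∈Y =
    1# , y , y∈Y , 1∉I ∘ proj₁ (Y⊆Δ y∈Y 1#) , ≈ᴹ-sym (*ₗ-identityˡ y)

  module _ (countable : Countable R) {I : Pred Carrier q} (I-maximal : IsMaximalLeftIdeal R I) where

    Δ-generated-by-multiple : ∀ {y r} → y ∈ Δ V I → ¬ (r *ₗ y ≈ᴹ 0ᴹ) →
                              ∃ λ s → y ≈ᴹ s *ₗ (r *ₗ y)
    Δ-generated-by-multiple {y} {r} y∈Δ ry≉0 = - t , y≈-t[ry]
      where
        1+tr∈I : ∃ λ t → I (1# + t * r)
        1+tr∈I = x∉maximal⇒1∈I+Rx R countable I-maximal (ry≉0 ∘ proj₂ (y∈Δ r))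
        t : Carrier
        t = proj₁ 1+tr∈I

        y≈-t[ry] : y ≈ᴹ - t *ₗ (r *ₗ y)
        y≈-t[ry] = begin
          y                                    ≈⟨ *ₗ-identityˡ y ⟨
          1# *ₗ y                              ≈⟨ *ₗ-congʳ (+-*-cancelʳ R 1# t r) ⟨
          ((1# + t * r) + - t * r) *ₗ y        ≈⟨ *ₗ-distribʳ y (1# + t * r) (- t * r) ⟩
          (1# + t * r) *ₗ y +ᴹ (- t * r) *ₗ y  ≈⟨ +ᴹ-congʳ (proj₂ (y∈Δ _) (proj₂ 1+tr∈I)) ⟩
          0ᴹ +ᴹ (- t * r) *ₗ y                 ≈⟨ +ᴹ-identityˡ _ ⟩
          (- t * r) *ₗ y                       ≈⟨ *ₗ-assoc (- t) r y ⟩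
          - t *ₗ (r *ₗ y)                      ∎

    Δ-multiple∈submodule⇒∈submodule : {W : Pred Carrierᴹ p} → IsSubmodule V W →
      ∀ {y r} → y ∈ Δ V I → ¬ (r *ₗ y ≈ᴹ 0ᴹ) → r *ₗ y ∈ W → y ∈ W
    Δ-multiple∈submodule⇒∈submodule (W-resp , _ , _ , W-*ₗ) y∈Δ ry≉0 ry∈W =
      let (s , y≈s[ry]) = Δ-generated-by-multiple y∈Δ ry≉0
      in W-resp (≈ᴹ-sym y≈s[ry]) (W-*ₗ s ry∈W)

    Rstar[Δ∖⋃ω]⊆∁⋃ω : {W : ℕ → Pred Carrierᴹ p} → (∀ n → IsSubmodule V (W n)) →
                      Rstar V (Δ V I ∩ ∁ (⋃ω V W)) ⊆ ∁ (⋃ω V W)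
    Rstar[Δ∖⋃ω]⊆∁⋃ω W-sub (r , y , (y∈Δ , y∉⋃W) , ry≉0 , a≈ry) (n , a∈Wn) =
      y∉⋃W (n , Δ-multiple∈submodule⇒∈submodule (W-sub n) y∈Δ ry≉0
                  (proj₁ (W-sub n) a≈ry a∈Wn))

  module _ {f : Carrierᴹ → Carrierᴹ} where

    ∩-invariant : {S : Pred Carrierᴹ p} {T : Pred Carrierᴹ q} →
                  InvariantUnder V S f → InvariantUnder V T f → InvariantUnder V (S ∩ T) f
    ∩-invariant S-inv T-inv a =
        (λ (a∈S , a∈T) → proj₁ (S-inv a) a∈S , proj₁ (T-inv a) a∈T)
      , (λ (fa∈S , fa∈T) → proj₂ (S-inv a) fa∈S , proj₂ (T-inv a) fa∈T)

    ∁-invariant : {S : Pred Carrierᴹ p} → InvariantUnder V S f → InvariantUnder V (∁ S) f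
    ∁-invariant S-inv a = (λ a∉S → a∉S ∘ proj₂ (S-inv a)) , (λ fa∉S → fa∉S ∘ proj₁ (S-inv a))

    ⋃ω-invariant : {W : ℕ → Pred Carrierᴹ p} →
                   (∀ n → InvariantUnder V (W n) f) → InvariantUnder V (⋃ω V W) f
    ⋃ω-invariant W-inv a =
        (λ (n , a∈Wn) → n , proj₁ (W-inv n a) a∈Wn)
      , (λ (n , fa∈Wn) → n , proj₂ (W-inv n a) fa∈Wn)

    ≐′-invariant : {S : Pred Carrierᴹ p} {T : Pred Carrierᴹ q} →
                   S ≐′ T → InvariantUnder V T f → InvariantUnder V S f
    ≐′-invariant S≐T T-inv a =
        (λ a∈S → proj₂ (S≐T (f a)) (proj₁ (T-inv a) (proj₁ (S≐T a) a∈S)))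
      , (λ fa∈S → proj₂ (S≐T a) (proj₂ (T-inv a) (proj₁ (S≐T (f a)) fa∈S)))

    module _ (f-iso : IsLeftModuleIsomorphism f) where
      open IsLeftModuleIsomorphism f-iso

      *ₗ-image≈0⇔*ₗ≈0 : ∀ s x → (s *ₗ f x ≈ᴹ 0ᴹ) ⇔′ (s *ₗ x ≈ᴹ 0ᴹ)
      *ₗ-image≈0⇔*ₗ≈0 s x =
          (λ s[fx]≈0 → injective (≈ᴹ-trans (*ₗ-homo s x) (≈ᴹ-trans s[fx]≈0 (≈ᴹ-sym 0ᴹ-homo))))
        , (λ sx≈0 → ≈ᴹ-trans (≈ᴹ-sym (*ₗ-homo s x)) (≈ᴹ-trans (⟦⟧-cong sx≈0) 0ᴹ-homo))

      Δ-invariant : {I : Pred Carrier q} → InvariantUnder V (Δ V I) f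
      Δ-invariant a =
          (λ a∈Δ s → proj₁ (a∈Δ s) ∘ proj₁ (*ₗ-image≈0⇔*ₗ≈0 s a)
                   , proj₂ (*ₗ-image≈0⇔*ₗ≈0 s a) ∘ proj₂ (a∈Δ s))
        , (λ fa∈Δ s → proj₁ (fa∈Δ s) ∘ proj₂ (*ₗ-image≈0⇔*ₗ≈0 s a)
                    , proj₁ (*ₗ-image≈0⇔*ₗ≈0 s a) ∘ proj₂ (fa∈Δ s))

      Rstar-invariant : {S : Pred Carrierᴹ p} → (∀ {y z} → y ≈ᴹ z → y ∈ S → z ∈ S) →
                        InvariantUnder V S f → InvariantUnder V (Rstar V S) f
      Rstar-invariant {S = S} S-resp S-inv a = image , preimage
        where
          image : a ∈ Rstar V S → f a ∈ Rstar V S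
          image (r , y , y∈S , ry≉0 , a≈ry) =
              r , f y , proj₁ (S-inv y) y∈S , ry≉0 ∘ proj₁ (*ₗ-image≈0⇔*ₗ≈0 r y)
            , ≈ᴹ-trans (⟦⟧-cong a≈ry) (*ₗ-homo r y)

          preimage : f a ∈ Rstar V S → a ∈ Rstar V S
          preimage (r , y , y∈S , ry≉0 , fa≈ry) =
              r , z , proj₂ (S-inv z) (S-resp (≈ᴹ-sym fz≈y) y∈S)
            , ry≉0 ∘ ≈ᴹ-trans (*ₗ-congˡ (≈ᴹ-sym fz≈y)) ∘ proj₂ (*ₗ-image≈0⇔*ₗ≈0 r z)
            , injective (≈ᴹ-trans fa≈ry (≈ᴹ-trans (*ₗ-congˡ (≈ᴹ-sym fz≈y)) (≈ᴹ-sym (*ₗ-homo r z))))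
            where
              z = proj₁ (surjective y)
              fz≈y : f z ≈ᴹ y
              fz≈y = proj₂ (surjective y) ≈ᴹ-refl

lemma2p9 : ∀ {c ℓ m ℓm p q} (R : Ring c ℓ) → Countable R →
    (I : Pred (Ring.Carrier R) q) → IsMaximalLeftIdeal R I →
    (V : LeftModule R m ℓm) (Vₙ : ℕ → Pred (LeftModule.Carrierᴹ V) p) →
    (∀ n → IsSubmodule V (Vₙ n)) →
    (X : Pred (LeftModule.Carrierᴹ V) p) → IsBasis V I X →
    ((∀ a → a ∈ Δ V I → ((a ∈ Rstar V X) ⇔′ ¬ (a ∈ ⋃ω V Vₙ)))
      ⇔′ (Rstar V X ≐′ Rstar V (Δ V I ∩ ∁ (⋃ω V Vₙ))))
    × ((∀ a → a ∈ Δ V I → ((a ∈ Rstar V X) ⇔′ ¬ (a ∈ ⋃ω V Vₙ))) →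
       ∀ f → IsAutomorphism V Vₙ f → InvariantUnder V (Rstar V X) f)
lemma2p9 {c} {ℓ} {m} {ℓm} {p} {q} R countable I I-maximal V Vₙ Vₙ-sub X (X-independent , _) = (⇒ , ⇐) , invariant
  where
    open Ring R using (1#)
    open LeftModule V using (Carrierᴹ; _≈ᴹ_; ≈ᴹ-sym)
    open LeftModuleProperties V

    D : Pred Carrierᴹ (c ⊔ ℓm ⊔ p ⊔ q)
    D = Δ V I ∩ ∁ (⋃ω V Vₙ)

    Characterisation : Set (c ⊔ m ⊔ ℓm ⊔ p ⊔ q)
    Characterisation = ∀ a → a ∈ Δ V I → ((a ∈ Rstar V X) ⇔′ ¬ (a ∈ ⋃ω V Vₙ))

    1∉I : ¬ (1# ∈ I)
    1∉I = proj₁ (proj₂ I-maximal)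
    X⊆Δ : X ⊆ Δ V I
    X⊆Δ = independent⇒⊆Δ X-independent

    ⇒ : Characterisation → Rstar V X ≐′ Rstar V D
    ⇒ H = ≐′-intro (Rstar-mono X⊆D) (Rstar-Rstar⊆Rstar ∘ Rstar-mono D⊆RstarX)
      where
        X⊆D : X ⊆ D
        X⊆D x∈X = X⊆Δ x∈X , proj₁ (H _ (X⊆Δ x∈X)) (⊆Δ⇒⊆Rstar 1∉I X⊆Δ x∈X)
        D⊆RstarX : D ⊆ Rstar V X
        D⊆RstarX (y∈Δ , y∉⋃) = proj₂ (H _ y∈Δ) y∉⋃

    ⇐ : Rstar V X ≐′ Rstar V D → Characterisation
    ⇐ X≐D a a∈Δ =
        Rstar[Δ∖⋃ω]⊆∁⋃ω countable I-maximal Vₙ-sub ∘ proj₁ (X≐D a)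
      , (λ a∉⋃ → proj₂ (X≐D a) (⊆Δ⇒⊆Rstar 1∉I proj₁ (a∈Δ , a∉⋃)))

    invariant : Characterisation → ∀ f → IsAutomorphism V Vₙ f → InvariantUnder V (Rstar V X) f
    invariant H f (f-iso , f-preserves-Vₙ) =
      ≐′-invariant (⇒ H) (Rstar-invariant f-iso D-resp
        (∩-invariant (Δ-invariant f-iso) (∁-invariant (⋃ω-invariant f-preserves-Vₙ))))
      where
        D-resp : ∀ {y z} → y ≈ᴹ z → y ∈ D → z ∈ D
        D-resp y≈z (y∈Δ , y∉⋃) = Δ-resp-≈ y≈z y∈Δ , y∉⋃ ∘ ⋃ω-resp-≈ Vₙ-sub (≈ᴹ-sym y≈z)
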